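{- Let $k,k'\in\mathbb{N}$ with $k\ge 2^{2k'}$, and let $\mathcal{H}_k$ be a non-empty collection of labelled graphs on $k$ vertices. Let $r=|\{d: \exists (H,\pi)\in\mathcal{H}_k \text{ with } |E(H)|=d\}|$ and suppose $$r\le\frac{1}{\binom{k-2}{k'-2}\binom{k'}{2}}\left(\frac{(2^{2k'}-k')!}{(2^{2k'})!}\cdot\frac{k!}{(k-k')!}\right).$$ Then there exists $(H,\pi)\in\mathcal{H}_k$ that is either good for $k'$-cliques or good for $k'$-independent sets (with respect to $\mathcal{H}_k$).
   Context: A labelled graph is a pair $(H,\pi)$ with $H$ a graph and $\pi:[|V(H)|]\to V(H)$ a bijection. Relative to a collection $\mathcal{H}_k$ of labelled graphs, $(H,\pi)\in\mathcal{H}_k$ is good for $k'$-cliques if there is a set $U$ of $k'$ vertices of $H$ inducing a clique such that there is no $(H',\pi')\in\mathcal{H}_k$ with $H'$ obtainable from $H$ by deleting (one or more) edges with both endpoints in $U$; it is good for $k'$-independent sets if there is a set $W$ of $k'$ vertices inducing an independent set such that there is no $(H',\pi')\in\mathcal{H}_k$ with $H'$ obtainable from $H$ by adding (one or more) edges with both endpoints in $W$. -}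

module Defs where

open import Data.Bool using (Bool; true; false; if_then_else_; _∧_)
open import Data.Nat using (ℕ; _<ᵇ_)
open import Data.Fin using (Fin; toℕ)
open import Data.Fin.Subset using (Subset; _∈_; ∣_∣)
open import Data.Fin.Permutation using (Permutation′)
open import Data.List using (List; map; allFin; deduplicate)
open import Data.Nat.ListAction using (sum)
open import Data.List.Relation.Unary.Any using (Any)
open import Data.Product using (_×_; Σ; ∃; ∃-syntax)
open import Relation.Binary.PropositionalEquality using (_≡_; _≢_)
open import Relation.Nullary using (¬_)
open import Data.Nat.Properties using (_≟_)

record Graph (k : ℕ) : Set where
  field
    adj    : Fin k → Fin k → Bool
    sym    : ∀ i j → adj i j ≡ adj j i
    irrefl : ∀ i → adj i i ≡ false
open Graph public

-- A labelled graph on k vertices: a graph H with V(H) = Fin k together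
-- with a bijection π : [k] → V(H).
record LabelledGraph (k : ℕ) : Set where
  constructor _,ₗ_
  field
    graph : Graph k
    label : Permutation′ k
open LabelledGraph public

edgeCount : ∀ {k} → Graph k → ℕ
edgeCount {k} G =
  sum (map (λ i → sum (map (λ j → if adj G i j ∧ (toℕ i <ᵇ toℕ j) then 1 else 0)
                           (allFin k)))
           (allFin k))

numEdgeCounts : ∀ {k} → List (LabelledGraph k) → ℕ
numEdgeCounts Hs = Data.List.length (deduplicate _≟_ (map (λ L → edgeCount (graph L)) Hs))
  where import Data.List

IsClique : ∀ {k} → Graph k → Subset k → Set
IsClique G U = ∀ i j → i ∈ U → j ∈ U → i ≢ j → adj G i j ≡ true

IsIndep : ∀ {k} → Graph k → Subset k → Set
IsIndep G W = ∀ i j → i ∈ W → j ∈ W → adj G i j ≡ false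

DeletedWithin : ∀ {k} → Graph k → Subset k → Graph k → Set
DeletedWithin H U H' =
  (∀ i j → adj H' i j ≡ true → adj H i j ≡ true) ×
  (∀ i j → adj H i j ≡ true → adj H' i j ≡ false → (i ∈ U × j ∈ U)) ×
  (∃[ i ] ∃[ j ] (adj H i j ≡ true × adj H' i j ≡ false))

AddedWithin : ∀ {k} → Graph k → Subset k → Graph k → Set
AddedWithin H W H' =
  (∀ i j → adj H i j ≡ true → adj H' i j ≡ true) ×
  (∀ i j → adj H' i j ≡ true → adj H i j ≡ false → (i ∈ W × j ∈ W)) ×
  (∃[ i ] ∃[ j ] (adj H' i j ≡ true × adj H i j ≡ false))

GoodForCliques : ∀ {k} → List (LabelledGraph k) → ℕ → LabelledGraph k → Set
GoodForCliques Hs k' L =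
  Σ (Subset _) λ U → ∣ U ∣ ≡ k' × IsClique (graph L) U ×
    ¬ Any (λ L' → DeletedWithin (graph L) U (graph L')) Hs

GoodForIndepSets : ∀ {k} → List (LabelledGraph k) → ℕ → LabelledGraph k → Set
GoodForIndepSets Hs k' L =
  Σ (Subset _) λ W → ∣ W ∣ ≡ k' × IsIndep (graph L) W ×
    ¬ Any (λ L' → AddedWithin (graph L) W (graph L')) Hs

-- Let L₀ be a member of Hs with the fewest edges. If L₀ has a k′-clique it is good for cliques, since deleting
-- edges lowers the edge count. Otherwise start at H = L₀ and, while H has an independent k′-set W for which H is
-- not good, move to a member of Hs obtained from H by adding edges inside W. Every move raises the edge count, so
-- there are fewer than r of them, and each adds at most k′(k′ - 1) arcs (ordered edges) outside L₀. If the walk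
-- reaches a graph H without independent k′-sets, Ramsey's theorem gives every set of M = 2^(2k′) vertices an
-- independent k′-set of L₀, hence an edge of H outside L₀, and averaging over subsets shows that H has at least
-- 2k(k - 1)/(M(M - 1)) arcs outside L₀. The hypothesis on r says that (r - 1) k′(k′ - 1) is smaller than that.

module Submission where

open import Defs hiding (sym)

open import Data.Bool using (Bool; true; false; if_then_else_; _∧_; _∨_; not)
import Data.Bool.Properties as Bool
open import Data.Empty using (⊥; ⊥-elim)
open import Data.Fin using (Fin; zero; suc; toℕ)
open import Data.Fin.Properties using (_≟_; toℕ-injective; all?; any?)
open import Data.Fin.Subset as Subset using (Subset; _∈_; ∣_∣)
open import Data.Fin.Subset.Properties using (_∈?_; anySubset?; ∣⊥∣≡0; ∉⊥)
open import Data.List using (List; []; _∷_; map; tabulate; allFin; length; filter; deduplicate)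
open import Data.List.Extrema.Nat using (argmin; argmin-sel; f[argmin]≤f[⊤]; f[argmin]≤f[xs])
open import Data.List.Membership.Propositional using (find; lose) renaming (_∈_ to _∈ˡ_)
open import Data.List.Membership.Propositional.Properties using (∈-map⁺; ∈-deduplicate⁺)
open import Data.List.Properties using (filter-notAll)
open import Data.List.Relation.Unary.All as All using (All; _∷_)
open import Data.List.Relation.Unary.Any as Any using (Any; here; there)
open import Data.Nat hiding (_≟_)
open import Data.Nat.Combinatorics using (_C_; nCk≡n!/k![n-k]!; k![n∸k]!∣n!)
open import Data.Nat.DivMod using (m/n*n≡m)
open import Data.Nat.Induction using (<-wellFounded)
import Data.Nat.ListAction as ListAction
open import Data.Nat.Properties renaming (_≟_ to _ℕ≟_)
open import Algebra.Properties.Semiring.Sum +-*-semiring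
  using (sum; sum-syntax; sum-cong-≗; sum-replicate-zero; ∑-comm; ∑-distrib-+; *-distribˡ-sum; *-distribʳ-sum)
open import Data.Nat.Tactic.RingSolver using (solve-∀)
open import Data.Product using (∃-syntax; _×_; _,_; proj₁; proj₂)
open import Data.Sum using (_⊎_; inj₁; inj₂; [_,_]′; map₂)
open import Data.Vec as Vec using (lookup)
open import Data.Vec.Properties using ([]=⇒lookup; lookup∘tabulate)
open import Function using (_∘_; id)
open import Function.Bundles using (Equivalence)
open import Induction.WellFounded using (Acc; acc)
open import Relation.Binary.Definitions using (Tri; tri<; tri≈; tri>)
open import Relation.Binary.PropositionalEquality
open import Relation.Nullary using (¬_; Dec; yes; no; does)
open import Relation.Nullary.Decidable using (dec-true; dec-false; _×-dec_; _→-dec_; ¬?)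
open import Relation.Unary using (Decidable)

private
  variable
    n : ℕ

∑-mono-≤ : {f g : Fin n → ℕ} → (∀ i → f i ≤ g i) → sum f ≤ sum g
∑-mono-≤ {zero}  f≤g = z≤n
∑-mono-≤ {suc n} f≤g = +-mono-≤ (f≤g zero) (∑-mono-≤ (f≤g ∘ suc))

∑-mono-< : {f g : Fin n → ℕ} → (∀ i → f i ≤ g i) → ∀ i → f i < g i → sum f < sum g
∑-mono-< f≤g zero    fi<gi = +-mono-<-≤ fi<gi (∑-mono-≤ (f≤g ∘ suc))
∑-mono-< f≤g (suc i) fi<gi = +-mono-≤-< (f≤g zero) (∑-mono-< (f≤g ∘ suc) i fi<gi)

f[i]≤∑f : ∀ (f : Fin n → ℕ) i → f i ≤ sum f
f[i]≤∑f f zero    = m≤m+n _ _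
f[i]≤∑f f (suc i) = ≤-trans (f[i]≤∑f (f ∘ suc) i) (m≤n+m _ (f zero))

f[i]+f[j]≤∑f : ∀ (f : Fin n → ℕ) {i j} → i ≢ j → f i + f j ≤ sum f
f[i]+f[j]≤∑f f {zero}  {zero}  0≢0 = ⊥-elim (0≢0 refl)
f[i]+f[j]≤∑f f {zero}  {suc j} _   = +-monoʳ-≤ (f zero) (f[i]≤∑f (f ∘ suc) j)
f[i]+f[j]≤∑f f {suc i} {zero}  _   =
  subst (_≤ sum f) (+-comm (f zero) (f (suc i))) (+-monoʳ-≤ (f zero) (f[i]≤∑f (f ∘ suc) i))
f[i]+f[j]≤∑f f {suc i} {suc j} i≢j =
  ≤-trans (f[i]+f[j]≤∑f (f ∘ suc) (i≢j ∘ cong suc)) (m≤n+m _ (f zero))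

-- Vertex sets as characteristic functions

⟦_⟧ : Bool → ℕ
⟦ b ⟧ = if b then 1 else 0

⟦∧⟧ : ∀ a b → ⟦ a ∧ b ⟧ ≡ ⟦ a ⟧ * ⟦ b ⟧
⟦∧⟧ false b = refl
⟦∧⟧ true  b = sym (+-identityʳ ⟦ b ⟧)

⟦⟧≤1 : ∀ b → ⟦ b ⟧ ≤ 1
⟦⟧≤1 false = z≤n
⟦⟧≤1 true  = ≤-refl

card : (Fin n → Bool) → ℕ
card S = sum λ i → ⟦ S i ⟧

full : Fin n → Bool
full _ = true

_⊆ᵇ_ : (Fin n → Bool) → (Fin n → Bool) → Set
S ⊆ᵇ T = ∀ i → S i ≡ true → T i ≡ true

_-_ : (Fin n → Bool) → Fin n → (Fin n → Bool)
(S - v) i = S i ∧ not (does (v ≟ i))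

insert : Fin n → (Fin n → Bool) → (Fin n → Bool)
insert v S i = does (v ≟ i) ∨ S i

does-sym : ∀ (i j : Fin n) → does (i ≟ j) ≡ does (j ≟ i)
does-sym zero    zero    = refl
does-sym zero    (suc j) = refl
does-sym (suc i) zero    = refl
does-sym (suc i) (suc j) = does-sym i j

card-full : ∀ n → card (full {n}) ≡ n
card-full zero    = refl
card-full (suc n) = cong suc (card-full n)

card-split : ∀ (S c : Fin n → Bool) → card (λ i → S i ∧ c i) + card (λ i → S i ∧ not (c i)) ≡ card S
card-split S c = trans (sym (∑-distrib-+ (λ i → ⟦ S i ∧ c i ⟧) (λ i → ⟦ S i ∧ not (c i) ⟧)))
                       (sum-cong-≗ λ i → split (S i) (c i))
  where
  split : ∀ a b → ⟦ a ∧ b ⟧ + ⟦ a ∧ not b ⟧ ≡ ⟦ a ⟧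
  split false b     = refl
  split true  false = refl
  split true  true  = refl

card-at : ∀ (S : Fin n → Bool) v → card (λ i → S i ∧ does (v ≟ i)) ≡ ⟦ S v ⟧
card-at {suc n} S zero rewrite Bool.∧-identityʳ (S zero) = trans (cong (⟦ S zero ⟧ +_) none) (+-identityʳ _)
  where
  none : card (λ i → S (suc i) ∧ false) ≡ 0
  none = trans (sum-cong-≗ λ i → cong ⟦_⟧ (Bool.∧-zeroʳ (S (suc i)))) (sum-replicate-zero n)
card-at {suc n} S (suc v) rewrite Bool.∧-zeroʳ (S zero) = card-at (S ∘ suc) v

card-pos : ∀ (S : Fin n → Bool) → 0 < card S → ∃[ v ] S v ≡ true
card-pos {suc n} S 0<card with S zero in S₀
... | true  = zero , S₀
... | false = let v , Sv = card-pos (S ∘ suc) 0<card in suc v , Sv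

card-delete : ∀ (S : Fin n → Bool) {v} → S v ≡ true → card S ≡ suc (card (S - v))
card-delete S {v} Sv = begin
  card S                                               ≡⟨ card-split S (λ i → does (v ≟ i)) ⟨
  card (λ i → S i ∧ does (v ≟ i)) + card (S - v)     ≡⟨ cong (_+ card (S - v)) (card-at S v) ⟩
  ⟦ S v ⟧ + card (S - v)                               ≡⟨ cong (λ b → ⟦ b ⟧ + card (S - v)) Sv ⟩
  suc (card (S - v))                                   ∎
  where open ≡-Reasoning

insert-delete : ∀ (S : Fin n → Bool) {v} → S v ≡ false → (insert v S - v) ≗ S
insert-delete S {v} Sv i with v ≟ i
... | yes refl = sym Sv
... | no _     = Bool.∧-identityʳ (S i)

card-insert : ∀ (S : Fin n → Bool) {v} → S v ≡ false → card (insert v S) ≡ suc (card S)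
card-insert S {v} Sv = trans (card-delete (insert v S) (cong (_∨ S v) (dec-true (v ≟ v) refl)))
                             (cong suc (sum-cong-≗ (cong ⟦_⟧ ∘ insert-delete S Sv)))

∣∣≡card : ∀ (W : Subset n) → ∣ W ∣ ≡ card (lookup W)
∣∣≡card Vec.[]          = refl
∣∣≡card (true Vec.∷ W)  = cong suc (∣∣≡card W)
∣∣≡card (false Vec.∷ W) = ∣∣≡card W

∧-true : ∀ {a b} → a ∧ b ≡ true → a ≡ true × b ≡ true
∧-true {true} {true} _ = refl , refl

delete-⊆ : ∀ (S : Fin n → Bool) {v} → (S - v) ⊆ᵇ S
delete-⊆ S i = proj₁ ∘ ∧-true

delete-self : ∀ (S : Fin n → Bool) v → (S - v) v ≡ false
delete-self S v = trans (cong (λ b → S v ∧ not b) (dec-true (v ≟ v) refl)) (Bool.∧-zeroʳ (S v))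

insert-cases : ∀ v (S : Fin n → Bool) {i} → insert v S i ≡ true → v ≡ i ⊎ S i ≡ true
insert-cases v S {i} eq with v ≟ i
... | yes v≡i = inj₁ v≡i
... | no _    = inj₂ eq

-- Ramsey's theorem

Monochromatic : ∀ {k} → Graph k → Bool → (Fin k → Bool) → Set
Monochromatic G c W = ∀ i j → W i ≡ true → W j ≡ true → i ≢ j → adj G i j ≡ c

MonochromaticSubset : ∀ {k} → Graph k → ℕ → ℕ → (Fin k → Bool) → Set
MonochromaticSubset G a b S =
  ∃[ c ] ∃[ W ] W ⊆ᵇ S × card W ≡ (if c then a else b) × Monochromatic G c W

module Neighbourhoods {k} (G : Graph k) {S : Fin k → Bool} {v} (Sv : S v ≡ true) where

  coloured : Bool → Bool → Bool
  coloured c b = if c then b else not b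

  coloured-true : ∀ c b → coloured c b ≡ true → b ≡ c
  coloured-true true  true  _ = refl
  coloured-true false false _ = refl

  N : Bool → Fin k → Bool
  N c i = (S - v) i ∧ coloured c (adj G v i)

  N⊆S : ∀ {c} → N c ⊆ᵇ S
  N⊆S {c} i = delete-⊆ S {v} i ∘ proj₁ ∘ ∧-true

  card-N : suc (card (N true) + card (N false)) ≡ card S
  card-N = trans (cong suc (card-split (S - v) (adj G v))) (sym (card-delete S Sv))

  extend : ∀ {c W t} → W ⊆ᵇ N c → card W ≡ t → Monochromatic G c W →
           ∃[ W′ ] W′ ⊆ᵇ S × card W′ ≡ suc t × Monochromatic G c W′
  extend {c} {W} W⊆N ∣W∣ mono = insert v W , ⊆S , trans (card-insert W v∉W) (cong suc ∣W∣) , mono′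
    where
    v∉W : W v ≡ false
    v∉W with W v in Wv
    ... | false = refl
    ... | true  with () ← trans (sym (delete-self S v)) (proj₁ (∧-true (W⊆N v Wv)))

    ⊆S : insert v W ⊆ᵇ S
    ⊆S i i∈ with insert-cases v W i∈
    ... | inj₁ refl = Sv
    ... | inj₂ Wi   = N⊆S i (W⊆N i Wi)

    from-v : ∀ j → W j ≡ true → adj G v j ≡ c
    from-v j Wj = coloured-true c (adj G v j) (proj₂ (∧-true (W⊆N j Wj)))

    mono′ : Monochromatic G c (insert v W)
    mono′ i j i∈ j∈ i≢j with insert-cases v W i∈ | insert-cases v W j∈
    ... | inj₂ Wi   | inj₂ Wj   = mono i j Wi Wj i≢j
    ... | inj₁ refl | inj₂ Wj   = from-v j Wj
    ... | inj₂ Wi   | inj₁ refl = trans (Graph.sym G i v) (from-v i Wi)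
    ... | inj₁ refl | inj₁ refl = ⊥-elim (i≢j refl)

module _ {k} (G : Graph k) where

  ramsey : ∀ a b (S : Fin k → Bool) → 2 ^ (a + b) ≤ card S → MonochromaticSubset G a b S
  ramsey zero    b       S _ = true  , (λ _ → false) , (λ _ ()) , sum-replicate-zero k , (λ _ _ ())
  ramsey (suc a) zero    S _ = false , (λ _ → false) , (λ _ ()) , sum-replicate-zero k , (λ _ _ ())
  ramsey (suc a) (suc b) S h = around (card-pos S (≤-trans (m^n>0 2 (suc a + suc b)) h))
    where
    around : ∃[ v ] S v ≡ true → MonochromaticSubset G (suc a) (suc b) S
    around (v , Sv) = choose (2 ^ (a + suc b) ≤? card (N true))
      where
      open Neighbourhoods G {S} {v} Sv

      lift : ∀ {c W} → W ⊆ᵇ N c → W ⊆ᵇ S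
      lift W⊆N i = N⊆S i ∘ W⊆N i

      choose : Dec (2 ^ (a + suc b) ≤ card (N true)) → MonochromaticSubset G (suc a) (suc b) S
      choose (yes big) with ramsey a (suc b) (N true) big
      ... | true  , W , W⊆N , ∣W∣ , mono = true  , extend W⊆N ∣W∣ mono
      ... | false , W , W⊆N , ∣W∣ , mono = false , W , lift W⊆N , ∣W∣ , mono
      choose (no small) with ramsey (suc a) b (N false) (subst (_≤ card (N false)) (cong (2 ^_) (+-suc a b)) big)
        where
        big : 2 ^ (a + suc b) ≤ card (N false)
        big = +-cancelˡ-≤ (2 ^ (a + suc b)) _ _ (begin
          2 ^ (a + suc b) + 2 ^ (a + suc b)    ≡⟨ cong (2 ^ (a + suc b) +_) (+-identityʳ _) ⟨
          2 ^ (suc a + suc b)                  ≤⟨ h ⟩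
          card S                               ≡⟨ card-N ⟨
          suc (card (N true)) + card (N false) ≤⟨ +-monoˡ-≤ _ (≰⇒> small) ⟩
          2 ^ (a + suc b) + card (N false)     ∎)
          where open ≤-Reasoning
      ... | false , W , W⊆N , ∣W∣ , mono = false , extend W⊆N ∣W∣ mono
      ... | true  , W , W⊆N , ∣W∣ , mono = true  , W , lift W⊆N , ∣W∣ , mono

-- Edge density forced by an edge in every m-set

⟦∧⟧-interchange : ∀ a b c d x y →
                  ⟦ a ⟧ * ⟦ (b ∧ x) ∧ (c ∧ y) ∧ d ⟧ ≡ ⟦ b ∧ c ∧ d ⟧ * ⟦ (a ∧ x) ∧ y ⟧
⟦∧⟧-interchange a b c d x y
  rewrite ⟦∧⟧ (b ∧ x) ((c ∧ y) ∧ d) | ⟦∧⟧ b x | ⟦∧⟧ (c ∧ y) d | ⟦∧⟧ c y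
        | ⟦∧⟧ b (c ∧ d) | ⟦∧⟧ c d | ⟦∧⟧ (a ∧ x) y | ⟦∧⟧ a x
  = interchange ⟦ a ⟧ ⟦ b ⟧ ⟦ c ⟧ ⟦ d ⟧ ⟦ x ⟧ ⟦ y ⟧
  where
  interchange : ∀ a b c d x y → a * ((b * x) * ((c * y) * d)) ≡ (b * (c * d)) * ((a * x) * y)
  interchange = solve-∀

*-distribˡ-∑∑ : ∀ {m} x (f : Fin m → Fin n → ℕ) →
                x * (∑[ i < m ] ∑[ j < n ] f i j) ≡ ∑[ i < m ] ∑[ j < n ] (x * f i j)
*-distribˡ-∑∑ x f = trans (*-distribˡ-sum x (λ i → ∑[ j < _ ] f i j)) (sum-cong-≗ λ i → *-distribˡ-sum x (f i))

card-delete₂ : ∀ (S : Fin n → Bool) {i j} → S i ≡ true → S j ≡ true → i ≢ j →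
               card ((S - i) - j) ≡ card S ∸ 2
card-delete₂ S {i} {j} Si Sj i≢j = sym (begin
  card S ∸ 2                  ≡⟨ cong (_∸ 2) (card-delete S Si) ⟩
  card (S - i) ∸ 1            ≡⟨ cong (_∸ 1) (card-delete (S - i) S-i∋j) ⟩
  card ((S - i) - j)          ∎)
  where
  open ≡-Reasoning
  S-i∋j : (S - i) j ≡ true
  S-i∋j = cong₂ (λ a b → a ∧ not b) Sj (dec-false (i ≟ j) i≢j)

module _ {n} (D : Graph n) where

  orderedEdges : (Fin n → Bool) → ℕ
  orderedEdges S = ∑[ i < n ] ∑[ j < n ] ⟦ S i ∧ S j ∧ adj D i j ⟧

  SpansEdge : (Fin n → Bool) → Set
  SpansEdge S = ∃[ i ] ∃[ j ] S i ≡ true × S j ≡ true × adj D i j ≡ true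

  ≢-if-adjacent : ∀ {i j} → adj D i j ≡ true → i ≢ j
  ≢-if-adjacent {i} dij refl with () ← trans (sym dij) (irrefl D i)

  spansEdge⇒2≤orderedEdges : ∀ S → SpansEdge S → 2 ≤ orderedEdges S
  spansEdge⇒2≤orderedEdges S (i , j , Si , Sj , dij) =
    ≤-trans (+-mono-≤ (arc Si Sj dij) (arc Sj Si (trans (Graph.sym D j i) dij)))
            (f[i]+f[j]≤∑f _ (≢-if-adjacent dij))
    where
    arc : ∀ {i j} → S i ≡ true → S j ≡ true → adj D i j ≡ true →
          1 ≤ ∑[ j′ < n ] ⟦ S i ∧ S j′ ∧ adj D i j′ ⟧
    arc {i} {j} Si Sj dij =
      subst (_≤ ∑[ j′ < n ] ⟦ S i ∧ S j′ ∧ adj D i j′ ⟧)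
            (cong₂ (λ a b → ⟦ a ∧ b ⟧) Si (cong₂ _∧_ Sj dij))
            (f[i]≤∑f (λ j′ → ⟦ S i ∧ S j′ ∧ adj D i j′ ⟧) j)

  -- Each arc (i, j) of S survives in exactly card S ∸ 2 of the sets S - v.
  orderedEdges-average : ∀ S → ∑[ v < n ] (⟦ S v ⟧ * orderedEdges (S - v)) ≡ (card S ∸ 2) * orderedEdges S
  orderedEdges-average S = begin
    ∑[ v < n ] (⟦ S v ⟧ * orderedEdges (S - v))
      ≡⟨ sum-cong-≗ (λ v → *-distribˡ-∑∑ ⟦ S v ⟧ (λ i j → arc (S - v) i j)) ⟩
    ∑[ v < n ] ∑[ i < n ] ∑[ j < n ] (⟦ S v ⟧ * arc (S - v) i j)
      ≡⟨ ∑-comm (λ v i → ∑[ j < n ] (⟦ S v ⟧ * arc (S - v) i j)) ⟩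
    ∑[ i < n ] ∑[ v < n ] ∑[ j < n ] (⟦ S v ⟧ * arc (S - v) i j)
      ≡⟨ sum-cong-≗ (λ i → ∑-comm (λ v j → ⟦ S v ⟧ * arc (S - v) i j)) ⟩
    ∑[ i < n ] ∑[ j < n ] ∑[ v < n ] (⟦ S v ⟧ * arc (S - v) i j)
      ≡⟨ sum-cong-≗ (λ i → sum-cong-≗ λ j →
           trans (sum-cong-≗ (survives i j)) (sym (*-distribˡ-sum (arc S i j) (λ v → ⟦ ((S - i) - j) v ⟧)))) ⟩
    ∑[ i < n ] ∑[ j < n ] (arc S i j * card ((S - i) - j))
      ≡⟨ sum-cong-≗ (λ i → sum-cong-≗ (weighted i)) ⟩
    ∑[ i < n ] ∑[ j < n ] ((card S ∸ 2) * arc S i j)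
      ≡⟨ *-distribˡ-∑∑ (card S ∸ 2) (arc S) ⟨
    (card S ∸ 2) * orderedEdges S ∎
    where
    open ≡-Reasoning
    arc : (Fin n → Bool) → Fin n → Fin n → ℕ
    arc T i j = ⟦ T i ∧ T j ∧ adj D i j ⟧

    survives : ∀ i j v → ⟦ S v ⟧ * arc (S - v) i j ≡ arc S i j * ⟦ ((S - i) - j) v ⟧
    survives i j v = trans (⟦∧⟧-interchange (S v) (S i) (S j) (adj D i j) _ _)
      (cong (arc S i j *_) (cong₂ (λ p q → ⟦ (S v ∧ not p) ∧ not q ⟧) (does-sym v i) (does-sym v j)))

    weighted : ∀ i j → arc S i j * card ((S - i) - j) ≡ (card S ∸ 2) * arc S i j
    weighted i j with S i ∧ S j ∧ adj D i j in e
    ... | false = sym (*-zeroʳ (card S ∸ 2))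
    ... | true  = let Si , e′ = ∧-true e ; Sj , dij = ∧-true e′ in
      trans (+-identityʳ _) (trans (card-delete₂ S Si Sj (≢-if-adjacent dij)) (sym (*-identityʳ _)))

  density : ∀ {m} → 2 ≤ m → (∀ S → card S ≡ m → SpansEdge S) →
            ∀ S → m ≤ card S → 2 * card S * (card S ∸ 1) ≤ orderedEdges S * (m * (m ∸ 1))
  density {m} (s≤s (s≤s (z≤n {m₂}))) spans S m≤∣S∣ = go (card S ∸ m) S (sym (m+[n∸m]≡n m≤∣S∣))
    where
    Z = m * (m ∸ 1)

    go : ∀ t S → card S ≡ m + t → 2 * card S * (card S ∸ 1) ≤ orderedEdges S * Z
    go zero S ∣S∣ = subst (λ s → 2 * s * (s ∸ 1) ≤ orderedEdges S * Z) (sym ∣S∣′)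
      (≤-trans (≤-reflexive (*-assoc 2 m (m ∸ 1))) (*-monoˡ-≤ Z (spansEdge⇒2≤orderedEdges S (spans S ∣S∣′))))
      where
      ∣S∣′ : card S ≡ m
      ∣S∣′ = trans ∣S∣ (+-identityʳ m)
    go (suc t) S ∣S∣ = subst (λ s → 2 * s * (s ∸ 1) ≤ orderedEdges S * Z) (sym ∣S∣′) (*-cancelˡ-≤ a (begin
      a * (2 * (2 + a) * (1 + a))                ≡⟨ rearrange a ⟩
      (2 + a) * B                                ≡⟨ cong (_* B) ∣S∣′ ⟨
      card S * B                                 ≡⟨ *-distribʳ-sum B (λ v → ⟦ S v ⟧) ⟩
      ∑[ v < n ] (⟦ S v ⟧ * B)                    ≤⟨ ∑-mono-≤ lift ⟩
      ∑[ v < n ] (⟦ S v ⟧ * (orderedEdges (S - v) * Z))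
        ≡⟨ trans (sum-cong-≗ λ v → sym (*-assoc ⟦ S v ⟧ (orderedEdges (S - v)) Z))
                   (sym (*-distribʳ-sum Z (λ v → ⟦ S v ⟧ * orderedEdges (S - v)))) ⟩
      (∑[ v < n ] (⟦ S v ⟧ * orderedEdges (S - v))) * Z
        ≡⟨ cong (_* Z) (orderedEdges-average S) ⟩
      (card S ∸ 2) * orderedEdges S * Z          ≡⟨ cong (λ s → (s ∸ 2) * orderedEdges S * Z) ∣S∣′ ⟩
      a * orderedEdges S * Z                     ≡⟨ *-assoc a (orderedEdges S) Z ⟩
      a * (orderedEdges S * Z)                   ∎))
      where
      open ≤-Reasoning
      a = suc (m₂ + t)
      B = 2 * (1 + a) * a
      ∣S∣′ : card S ≡ 2 + a
      ∣S∣′ = trans ∣S∣ (cong (λ x → 2 + x) (+-suc m₂ t))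
      rearrange : ∀ a → a * (2 * (2 + a) * (1 + a)) ≡ (2 + a) * (2 * (1 + a) * a)
      rearrange = solve-∀
      lift : ∀ v → ⟦ S v ⟧ * B ≤ ⟦ S v ⟧ * (orderedEdges (S - v) * Z)
      lift v with S v in Sv
      ... | false = z≤n
      ... | true  = *-monoʳ-≤ 1 (subst (λ s → 2 * s * (s ∸ 1) ≤ orderedEdges (S - v) * Z) ∣S-v∣
                                       (go t (S - v) ∣S-v∣))
        where
        ∣S-v∣ : card (S - v) ≡ 1 + a
        ∣S-v∣ = suc-injective (trans (sym (card-delete S Sv)) ∣S∣′)

_∖_ : ∀ {k} → Graph k → Graph k → Graph k
H ∖ G = record
  { adj    = λ i j → adj H i j ∧ not (adj G i j)
  ; sym    = λ i j → cong₂ (λ a b → a ∧ not b) (Graph.sym H i j) (Graph.sym G i j)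
  ; irrefl = λ i → cong (_∧ not (adj G i i)) (irrefl H i)
  }

complete : ∀ k → Graph k
complete k = record
  { adj    = λ i j → not (does (i ≟ j))
  ; sym    = λ i j → cong not (does-sym i j)
  ; irrefl = λ i → cong not (dec-true (i ≟ i) refl)
  }

orderedEdges-∖-self : ∀ {k} (G : Graph k) S → orderedEdges (G ∖ G) S ≡ 0
orderedEdges-∖-self {k} G S =
  trans (sum-cong-≗ λ i → trans (sum-cong-≗ λ j → none (S i) (S j) (adj G i j)) (sum-replicate-zero k))
        (sum-replicate-zero k)
  where
  none : ∀ a b c → ⟦ a ∧ b ∧ c ∧ not c ⟧ ≡ 0
  none a b c rewrite Bool.∧-inverseʳ c | Bool.∧-zeroʳ b | Bool.∧-zeroʳ a = refl

orderedEdges-complete : ∀ {k} (W : Fin k → Bool) → orderedEdges (complete k) W ≡ card W * (card W ∸ 1)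
orderedEdges-complete {k} W = trans (sum-cong-≗ row) (sym (*-distribʳ-sum (card W ∸ 1) (λ i → ⟦ W i ⟧)))
  where
  row : ∀ i → ∑[ j < k ] ⟦ W i ∧ W j ∧ not (does (i ≟ j)) ⟧ ≡ ⟦ W i ⟧ * (card W ∸ 1)
  row i with W i in Wi
  ... | false = sum-replicate-zero k
  ... | true  = sym (trans (+-identityʳ _) (cong (_∸ 1) (card-delete W Wi)))

_⊆ᴱ_ : ∀ {k} → Graph k → Graph k → Set
G ⊆ᴱ H = ∀ i j → adj G i j ≡ true → adj H i j ≡ true

sum-map-tabulate : ∀ {A : Set} (f : A → ℕ) (g : Fin n → A) →
                   ListAction.sum (map f (tabulate g)) ≡ ∑[ i < n ] f (g i)
sum-map-tabulate {zero}  f g = refl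
sum-map-tabulate {suc n} f g = cong (f (g zero) +_) (sum-map-tabulate f (g ∘ suc))

edgeCount≡∑ : ∀ {k} (G : Graph k) →
              edgeCount G ≡ ∑[ i < k ] ∑[ j < k ] ⟦ adj G i j ∧ (toℕ i <ᵇ toℕ j) ⟧
edgeCount≡∑ {k} G = trans (sum-map-tabulate (λ i → ListAction.sum (map (row i) (allFin k))) (λ i → i))
                          (sum-cong-≗ λ i → sum-map-tabulate (row i) (λ j → j))
  where
  row : Fin k → Fin k → ℕ
  row i j = ⟦ adj G i j ∧ (toℕ i <ᵇ toℕ j) ⟧

edgeCount-< : ∀ {k} {G H : Graph k} → G ⊆ᴱ H → (∃[ i ] ∃[ j ] adj H i j ≡ true × adj G i j ≡ false) →
              edgeCount G < edgeCount H
edgeCount-< {k} {G} {H} G⊆H (i , j , Hij , Gij) =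
  subst₂ _<_ (sym (edgeCount≡∑ G)) (sym (edgeCount≡∑ H)) (oriented (<-cmp (toℕ i) (toℕ j)))
  where
  upper : Graph k → Fin k → Fin k → ℕ
  upper G i j = ⟦ adj G i j ∧ (toℕ i <ᵇ toℕ j) ⟧

  upper-mono : ∀ i j → upper G i j ≤ upper H i j
  upper-mono i j with adj G i j in Gij
  ... | false = z≤n
  ... | true  rewrite G⊆H i j Gij = ≤-refl

  strict : ∀ {i j} → adj H i j ≡ true → adj G i j ≡ false → toℕ i < toℕ j →
           ∑[ i < k ] ∑[ j < k ] upper G i j < ∑[ i < k ] ∑[ j < k ] upper H i j
  strict {i} {j} Hij Gij i<j = ∑-mono-< (λ i′ → ∑-mono-≤ (upper-mono i′)) i (∑-mono-< (upper-mono i) j missing)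
    where
    missing : upper G i j < upper H i j
    missing rewrite Hij | Gij | Equivalence.to Bool.T-≡ (<⇒<ᵇ i<j) = s≤s z≤n

  oriented : Tri (toℕ i < toℕ j) (toℕ i ≡ toℕ j) (toℕ j < toℕ i) →
             ∑[ i < k ] ∑[ j < k ] upper G i j < ∑[ i < k ] ∑[ j < k ] upper H i j
  oriented (tri< i<j _ _) = strict Hij Gij i<j
  oriented (tri≈ _ i≡j _) with refl ← toℕ-injective i≡j with () ← trans (sym Hij) (irrefl H i)
  oriented (tri> _ _ j<i) = strict (trans (Graph.sym H j i) Hij) (trans (Graph.sym G j i) Gij) j<i

orderedEdges-added : ∀ {k} (G : Graph k) {H H′ : Graph k} {W} → AddedWithin H W H′ →
  orderedEdges (H′ ∖ G) full ≤ orderedEdges (H ∖ G) full + orderedEdges (complete k) (lookup W)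
orderedEdges-added {k} G {H} {H′} {W} (_ , new⊆W , _) = begin
  ∑[ i < k ] ∑[ j < k ] old⁺ i j
    ≤⟨ ∑-mono-≤ (λ i → ∑-mono-≤ (pointwise i)) ⟩
  ∑[ i < k ] ∑[ j < k ] (old i j + inW i j)
    ≡⟨ sum-cong-≗ (λ i → ∑-distrib-+ (old i) (inW i)) ⟩
  ∑[ i < k ] (∑[ j < k ] old i j + ∑[ j < k ] inW i j)
    ≡⟨ ∑-distrib-+ (λ i → ∑[ j < k ] old i j) _ ⟩
  ∑[ i < k ] ∑[ j < k ] old i j + ∑[ i < k ] ∑[ j < k ] inW i j ∎
  where
  open ≤-Reasoning
  old⁺ old inW : Fin k → Fin k → ℕ
  old⁺ i j = ⟦ adj H′ i j ∧ not (adj G i j) ⟧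
  old  i j = ⟦ adj H i j ∧ not (adj G i j) ⟧
  inW  i j = ⟦ lookup W i ∧ lookup W j ∧ not (does (i ≟ j)) ⟧

  pointwise : ∀ i j → old⁺ i j ≤ old i j + inW i j
  pointwise i j with adj H′ i j in H′ij | adj H i j in Hij
  ... | false | _     = z≤n
  ... | true  | true  = m≤m+n _ _
  ... | true  | false with i∈W , j∈W ← new⊆W i j H′ij Hij
    rewrite []=⇒lookup i∈W | []=⇒lookup j∈W | dec-false (i ≟ j) (≢-if-adjacent H′ H′ij) =
      ⟦⟧≤1 (not (adj G i j))

HasClique : ∀ {k} → Graph k → ℕ → Set
HasClique G k′ = ∃[ U ] ∣ U ∣ ≡ k′ × IsClique G U

HasIndepSet : ∀ {k} → Graph k → ℕ → Set
HasIndepSet G k′ = ∃[ W ] ∣ W ∣ ≡ k′ × IsIndep G W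

positive-if-no-clique : ∀ {k} {G : Graph k} k′ → ¬ HasClique G k′ → 1 ≤ k′
positive-if-no-clique {k} zero    noClique =
  ⊥-elim (noClique (Subset.⊥ , ∣⊥∣≡0 k , λ _ _ i∈⊥ → ⊥-elim (∉⊥ i∈⊥)))
positive-if-no-clique         (suc _) _      = s≤s z≤n

toSubset : (Fin n → Bool) → Subset n
toSubset = Vec.tabulate

∈-toSubset : ∀ (S : Fin n → Bool) {i} → i ∈ toSubset S → S i ≡ true
∈-toSubset S {i} i∈S = trans (sym (lookup∘tabulate S i)) ([]=⇒lookup i∈S)

∣toSubset∣ : ∀ (S : Fin n → Bool) → ∣ toSubset S ∣ ≡ card S
∣toSubset∣ S = trans (∣∣≡card (Vec.tabulate S)) (sum-cong-≗ λ i → cong ⟦_⟧ (lookup∘tabulate S i))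

module _ {k} (G : Graph k) where

  clique⇒HasClique : ∀ {S} → Monochromatic G true S → HasClique G (card S)
  clique⇒HasClique {S} mono =
    toSubset S , ∣toSubset∣ S , λ i j i∈ j∈ → mono i j (∈-toSubset S i∈) (∈-toSubset S j∈)

  ¬spansEdge⇒HasIndepSet : ∀ {S} → ¬ SpansEdge G S → HasIndepSet G (card S)
  ¬spansEdge⇒HasIndepSet {S} noEdge = toSubset S , ∣toSubset∣ S , indep
    where
    indep : IsIndep G (toSubset S)
    indep i j i∈ j∈ with adj G i j in Gij
    ... | false = refl
    ... | true  = ⊥-elim (noEdge (i , j , ∈-toSubset S i∈ , ∈-toSubset S j∈ , Gij))

  isClique? : ∀ U → Dec (IsClique G U)
  isClique? U = all? λ i → all? λ j →
    (i ∈? U) →-dec (j ∈? U) →-dec ¬? (i ≟ j) →-dec (adj G i j Bool.≟ true)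

  isIndep? : ∀ W → Dec (IsIndep G W)
  isIndep? W = all? λ i → all? λ j → (i ∈? W) →-dec (j ∈? W) →-dec (adj G i j Bool.≟ false)

  hasClique? : ∀ k′ → Dec (HasClique G k′)
  hasClique? k′ = anySubset? λ U → (∣ U ∣ ℕ≟ k′) ×-dec isClique? U

  hasIndepSet? : ∀ k′ → Dec (HasIndepSet G k′)
  hasIndepSet? k′ = anySubset? λ W → (∣ W ∣ ℕ≟ k′) ×-dec isIndep? W

  spansEdge? : ∀ S → Dec (SpansEdge G S)
  spansEdge? S = any? λ i → any? λ j → (S i Bool.≟ true) ×-dec (S j Bool.≟ true) ×-dec (adj G i j Bool.≟ true)

addedWithin? : ∀ {k} (H : Graph k) W H′ → Dec (AddedWithin H W H′)
addedWithin? H W H′ =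
  (all? λ i → all? λ j → (adj H i j Bool.≟ true) →-dec (adj H′ i j Bool.≟ true)) ×-dec
  (all? λ i → all? λ j →
    (adj H′ i j Bool.≟ true) →-dec (adj H i j Bool.≟ false) →-dec ((i ∈? W) ×-dec (j ∈? W))) ×-dec
  (any? λ i → any? λ j → (adj H′ i j Bool.≟ true) ×-dec (adj H i j Bool.≟ false))

2≤2^[2*n] : ∀ {n} → 1 ≤ n → 2 ≤ 2 ^ (2 * n)
2≤2^[2*n] {n} 1≤n = ^-monoʳ-≤ 2 (≤-trans 1≤n (m≤n*m n 2))

-- Ramsey's theorem puts a k′-independent set of G inside every 2^(2k′)-set, and H has an edge inside it.
difference-dense : ∀ {k} k′ {G H : Graph k} → 1 ≤ k′ → 2 ^ (2 * k′) ≤ k →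
  ¬ HasClique G k′ → ¬ HasIndepSet H k′ →
  2 * k * (k ∸ 1) ≤ orderedEdges (H ∖ G) full * (2 ^ (2 * k′) * (2 ^ (2 * k′) ∸ 1))
difference-dense {k} k′ {G} {H} 1≤k′ M≤k noClique noIndep =
  subst (λ s → 2 * s * (s ∸ 1) ≤ orderedEdges (H ∖ G) full * (M * (M ∸ 1))) (card-full k)
    (density (H ∖ G) 2≤M spans full (subst (M ≤_) (sym (card-full k)) M≤k))
  where
  M = 2 ^ (2 * k′)

  2≤M : 2 ≤ M
  2≤M = 2≤2^[2*n] 1≤k′

  spans : ∀ S → card S ≡ M → SpansEdge (H ∖ G) S
  spans S ∣S∣ with ramsey G k′ k′ S (≤-reflexive (trans (cong (λ x → 2 ^ (k′ + x)) (sym (+-identityʳ k′)))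
                                                        (sym ∣S∣)))
  ... | true  , W , _ , ∣W∣ , clique = ⊥-elim (noClique (subst (HasClique G) ∣W∣ (clique⇒HasClique G clique)))
  ... | false , W , W⊆S , ∣W∣ , indep with spansEdge? H W
  ...   | no noEdge = ⊥-elim (noIndep (subst (HasIndepSet H) ∣W∣ (¬spansEdge⇒HasIndepSet H noEdge)))
  ...   | yes (i , j , Wi , Wj , Hij) = i , j , W⊆S i Wi , W⊆S j Wj , new
    where
    new : adj H i j ∧ not (adj G i j) ≡ true
    new rewrite Hij | indep i j Wi Wj (≢-if-adjacent H Hij) = refl

module _ {A : Set} {P Q : A → Set} (P? : Decidable P) (Q? : Decidable Q) (P⇒Q : ∀ {x} → P x → Q x) where

  length-filter-mono : ∀ xs → length (filter P? xs) ≤ length (filter Q? xs)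
  length-filter-mono []       = z≤n
  length-filter-mono (y ∷ ys) with P? y | Q? y
  ... | yes _  | yes _  = s≤s (length-filter-mono ys)
  ... | yes Py | no ¬Qy = ⊥-elim (¬Qy (P⇒Q Py))
  ... | no _   | yes _  = m≤n⇒m≤1+n (length-filter-mono ys)
  ... | no _   | no _   = length-filter-mono ys

  length-filter-< : ∀ {x xs} → x ∈ˡ xs → Q x → ¬ P x → length (filter P? xs) < length (filter Q? xs)
  length-filter-< {x} {y ∷ ys} (here refl) Qx ¬Px with P? y | Q? y
  ... | yes Px | _      = ⊥-elim (¬Px Px)
  ... | no _   | yes _  = s≤s (length-filter-mono ys)
  ... | no _   | no ¬Qx = ⊥-elim (¬Qx Qx)
  length-filter-< {x} {y ∷ ys} (there x∈ys) Qx ¬Px with P? y | Q? y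
  ... | yes _  | yes _  = s≤s (length-filter-< x∈ys Qx ¬Px)
  ... | yes Py | no ¬Qy = ⊥-elim (¬Qy (P⇒Q Py))
  ... | no _   | yes _  = m<n⇒m<1+n (length-filter-< x∈ys Qx ¬Px)
  ... | no _   | no _   = length-filter-< x∈ys Qx ¬Px

edgeCountOf : ∀ {k} → LabelledGraph k → ℕ
edgeCountOf L = edgeCount (graph L)

module _ {k} (Hs : List (LabelledGraph k)) where

  edgeCounts : List ℕ
  edgeCounts = deduplicate _ℕ≟_ (map edgeCountOf Hs)

  edgeCountsAbove : ℕ → ℕ
  edgeCountsAbove e = length (filter (e <?_) edgeCounts)

  edgeCountOf∈edgeCounts : ∀ {L} → L ∈ˡ Hs → edgeCountOf L ∈ˡ edgeCounts
  edgeCountOf∈edgeCounts L∈ = ∈-deduplicate⁺ _ℕ≟_ (∈-map⁺ edgeCountOf L∈)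

  edgeCountsAbove-< : ∀ {L e} → L ∈ˡ Hs → e < edgeCountOf L → edgeCountsAbove (edgeCountOf L) < edgeCountsAbove e
  edgeCountsAbove-< L∈ e<L = length-filter-< (_ <?_) (_ <?_) (<-trans e<L) (edgeCountOf∈edgeCounts L∈) e<L (<-irrefl refl)

  edgeCountsAbove<numEdgeCounts : ∀ {L} → L ∈ˡ Hs → edgeCountsAbove (edgeCountOf L) < numEdgeCounts Hs
  edgeCountsAbove<numEdgeCounts L∈ =
    filter-notAll (_ <?_) edgeCounts (Any.map (λ { refl → <-irrefl refl }) (edgeCountOf∈edgeCounts L∈))

binomial*factorials : ∀ {n k} → k ≤ n → (n C k) * (k ! * (n ∸ k) !) ≡ n !
binomial*factorials {n} {k} k≤n =
  trans (cong (_* (k ! * (n ∸ k) !)) (nCk≡n!/k![n-k]! k≤n)) (m/n*n≡m (k![n∸k]!∣n! k≤n))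
  where instance _ = k !* (n ∸ k) !≢0

-- With k′ = 2 + j, M = 2 + m and k = 2 + n, multiplying the hypothesis by 2 j! and cancelling n! j! (m ∸ j)!
-- leaves r k′ (k′ - 1) M (M - 1) (m choose j) ≤ 2 k (k - 1).
hypothesis⇒bound : ∀ r {k k′ M} → k′ ≤ M → M ≤ k →
  r * ((k ∸ 2) C (k′ ∸ 2)) * (k′ C 2) * M ! * (k ∸ k′) ! ≤ (M ∸ k′) ! * k ! →
  r * (k′ * (k′ ∸ 1)) * (M * (M ∸ 1)) ≤ 2 * k * (k ∸ 1)
hypothesis⇒bound r {k′ = 0} _ _ _ rewrite *-zeroʳ r = z≤n
hypothesis⇒bound r {k′ = 1} _ _ _ rewrite *-zeroʳ r = z≤n
hypothesis⇒bound r {2+ n} {2+ j} {2+ m} (s≤s (s≤s j≤m)) (s≤s (s≤s m≤n)) hyp =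
  *-cancelʳ-≤ (r * kk * Z) (2 * (2 + n) * (1 + n)) K (begin
    r * kk * Z * K                                          ≤⟨ *-monoˡ-≤ K (m≤m*n (r * kk * Z) c₃) ⟩
    r * kk * Z * c₃ * K                                     ≡⟨ lhs ⟨
    r * c₁ * c₂ * (2 + m) ! * (n ∸ j) ! * (2 * j !)         ≤⟨ *-monoˡ-≤ (2 * j !) hyp ⟩
    (m ∸ j) ! * (2 + n) ! * (2 * j !)                       ≡⟨ rhs (n !) (j !) ((m ∸ j) !) n ⟩
    2 * (2 + n) * (1 + n) * K                               ∎)
  where
  open ≤-Reasoning
  c₁ = n C j
  c₂ = (2 + j) C 2
  c₃ = m C j
  kk = (2 + j) * (1 + j)
  Z  = (2 + m) * (1 + m)
  K  = n ! * j ! * (m ∸ j) !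
  instance
    K≢0 : NonZero K
    K≢0 = m*n≢0 (n ! * j !) ((m ∸ j) !) {{m*n≢0 (n !) (j !) {{n !≢0}} {{j !≢0}}}} {{(m ∸ j) !≢0}}
    c₃≢0 : NonZero c₃
    c₃≢0 = m*n≢0⇒m≢0 c₃ {{subst NonZero (sym (binomial*factorials j≤m)) (m !≢0)}}

  2c₂≡kk : 2 * c₂ ≡ kk
  2c₂≡kk = *-cancelʳ-≡ (2 * c₂) kk (j !) {{j !≢0}} (begin-equality
    2 * c₂ * j !           ≡⟨ trans (*-assoc 2 c₂ (j !)) (x*[y*z]≡y*[x*z] 2 c₂ (j !)) ⟩
    c₂ * (2 ! * j !)       ≡⟨ binomial*factorials (s≤s (s≤s (z≤n {j}))) ⟩
    (2 + j) !              ≡⟨ *-assoc (2 + j) (1 + j) (j !) ⟨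
    kk * j !               ∎)
    where
    x*[y*z]≡y*[x*z] : ∀ x y z → x * (y * z) ≡ y * (x * z)
    x*[y*z]≡y*[x*z] = solve-∀

  lhs : r * c₁ * c₂ * (2 + m) ! * (n ∸ j) ! * (2 * j !) ≡ r * kk * Z * c₃ * K
  lhs = begin-equality
    r * c₁ * c₂ * ((2 + m) * ((1 + m) * m !)) * (n ∸ j) ! * (2 * j !)
      ≡⟨ cong (λ x → r * c₁ * c₂ * ((2 + m) * ((1 + m) * x)) * (n ∸ j) ! * (2 * j !))
              (binomial*factorials j≤m) ⟨
    r * c₁ * c₂ * ((2 + m) * ((1 + m) * (c₃ * (j ! * (m ∸ j) !)))) * (n ∸ j) ! * (2 * j !)
      ≡⟨ regroup r c₁ c₂ c₃ m (j !) ((n ∸ j) !) ((m ∸ j) !) ⟩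
    r * (2 * c₂) * Z * c₃ * (c₁ * (j ! * (n ∸ j) !) * j ! * (m ∸ j) !)
      ≡⟨ cong₂ (λ x y → r * x * Z * c₃ * (y * j ! * (m ∸ j) !))
               2c₂≡kk (binomial*factorials (≤-trans j≤m m≤n)) ⟩
    r * kk * Z * c₃ * K ∎
    where
    regroup : ∀ r c₁ c₂ c₃ m F G G′ →
      r * c₁ * c₂ * ((2 + m) * ((1 + m) * (c₃ * (F * G′)))) * G * (2 * F) ≡
      r * (2 * c₂) * ((2 + m) * (1 + m)) * c₃ * (c₁ * (F * G) * F * G′)
    regroup = solve-∀

  rhs : ∀ N F G′ n → G′ * ((2 + n) * ((1 + n) * N)) * (2 * F) ≡ 2 * (2 + n) * (1 + n) * (N * F * G′)
  rhs = solve-∀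

n<2^n : ∀ n → n < 2 ^ n
n<2^n zero    = s≤s z≤n
n<2^n (suc n) = +-mono-≤ (m^n>0 2 n) (≤-trans (n<2^n n) (≤-reflexive (sym (+-identityʳ (2 ^ n)))))

climb-step : ∀ {x x′ c a a′} → x′ ≤ x + c → a′ < a → x′ + c * a′ ≤ x + c * a
climb-step {x} {x′} {c} {a} {a′} x′≤x+c a′<a = begin
  x′ + c * a′        ≤⟨ +-monoˡ-≤ (c * a′) x′≤x+c ⟩
  x + c + c * a′     ≡⟨ trans (+-assoc x c (c * a′)) (cong (x +_) (sym (*-suc c a′))) ⟩
  x + c * suc a′     ≤⟨ +-monoʳ-≤ x (*-monoʳ-≤ c a′<a) ⟩
  x + c * a          ∎
  where open ≤-Reasoning

no-room : ∀ {A r a x} → a < r → r * x ≤ A → A ≤ a * x → 0 < A → ⊥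
no-room {A} {r} {a} {x} a<r rx≤A A≤ax 0<A
  with refl ← n≤0⇒n≡0 (+-cancelʳ-≤ (a * x) x 0 (≤-trans (*-monoˡ-≤ x a<r) (≤-trans rx≤A A≤ax))) =
  <-irrefl refl (≤-trans 0<A (≤-trans A≤ax (≤-reflexive (*-zeroʳ a))))

-- Climbing through Hs

module _ {k} (k′ : ℕ) (Hs : List (LabelledGraph k)) where

  Good : LabelledGraph k → Set
  Good L = GoodForCliques Hs k′ L ⊎ GoodForIndepSets Hs k′ L

  -- Deleting edges lowers the edge count, so no member of Hs arises from a minimal one that way.
  minimal⇒GoodForCliques : ∀ {L₀} → All (λ L → edgeCountOf L₀ ≤ edgeCountOf L) Hs →
                           HasClique (graph L₀) k′ → GoodForCliques Hs k′ L₀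
  minimal⇒GoodForCliques {L₀} L₀-min (U , ∣U∣ , clique) = U , ∣U∣ , clique , λ deleted →
    let L , L∈ , L₀-U≡L = find deleted in
    <⇒≱ (edgeCount-< {G = graph L} {graph L₀} (proj₁ L₀-U≡L) (proj₂ (proj₂ L₀-U≡L)))
        (All.lookup L₀-min L∈)

  module Climb (H₀ : Graph k) (1≤k′ : 1 ≤ k′) (M≤k : 2 ^ (2 * k′) ≤ k) (noClique : ¬ HasClique H₀ k′) where

    M = 2 ^ (2 * k′)
    Z = M * (M ∸ 1)
    kk = k′ * (k′ ∸ 1)

    newArcs above : LabelledGraph k → ℕ
    newArcs L = orderedEdges (graph L ∖ H₀) full
    above   L = edgeCountsAbove Hs (edgeCountOf L)

    climb : ∀ L → L ∈ˡ Hs → Acc _<_ (above L) →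
            Any Good Hs ⊎ 2 * k * (k ∸ 1) ≤ Z * (newArcs L + kk * above L)
    climb L L∈ (acc more) with hasIndepSet? (graph L) k′
    ... | no noIndep = inj₂ (begin
      2 * k * (k ∸ 1)              ≤⟨ difference-dense k′ {H₀} {graph L} 1≤k′ M≤k noClique noIndep ⟩
      newArcs L * Z                ≡⟨ *-comm (newArcs L) Z ⟩
      Z * newArcs L                ≤⟨ *-monoʳ-≤ Z (m≤m+n _ _) ⟩
      Z * (newArcs L + kk * above L) ∎)
      where open ≤-Reasoning
    ... | yes (W , ∣W∣ , indep) with Any.any? (λ L′ → addedWithin? (graph L) W (graph L′)) Hs
    ...   | no stuck = inj₁ (lose L∈ (inj₂ (W , ∣W∣ , indep , stuck)))
    ...   | yes added with find added
    ...     | L′ , L′∈ , L+W≡L′ = map₂ (λ ih → ≤-trans ih progress) (climb L′ L′∈ (more fewer))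
      where
      fewer : above L′ < above L
      fewer = edgeCountsAbove-< Hs L′∈
                (edgeCount-< {G = graph L} {graph L′} (proj₁ L+W≡L′) (proj₂ (proj₂ L+W≡L′)))

      grow : newArcs L′ ≤ newArcs L + kk
      grow = ≤-trans (orderedEdges-added H₀ {graph L} {graph L′} L+W≡L′)
                     (≤-reflexive (cong (newArcs L +_) new≡kk))
        where
        new≡kk : orderedEdges (complete k) (lookup W) ≡ kk
        new≡kk = trans (orderedEdges-complete (lookup W))
                       (cong (λ x → x * (x ∸ 1)) (trans (sym (∣∣≡card W)) ∣W∣))

      progress : Z * (newArcs L′ + kk * above L′) ≤ Z * (newArcs L + kk * above L)
      progress = *-monoʳ-≤ Z (climb-step {newArcs L} {newArcs L′} {kk} grow fewer)

  good-from-minimal : 2 ^ (2 * k′) ≤ k →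
    numEdgeCounts Hs * (k′ * (k′ ∸ 1)) * (2 ^ (2 * k′) * (2 ^ (2 * k′) ∸ 1)) ≤ 2 * k * (k ∸ 1) →
    ∀ {L₀} → L₀ ∈ˡ Hs → All (λ L → edgeCountOf L₀ ≤ edgeCountOf L) Hs → Any Good Hs
  good-from-minimal M≤k bound {L₀} L₀∈ L₀-min with hasClique? (graph L₀) k′
  ... | yes clique  = lose L₀∈ (inj₁ (minimal⇒GoodForCliques {L₀} L₀-min clique))
  ... | no noClique = [ id , ⊥-elim ∘ contradiction ]′ (climb L₀ L₀∈ (<-wellFounded _))
    where
    1≤k′ = positive-if-no-clique {G = graph L₀} k′ noClique
    open Climb (graph L₀) 1≤k′ M≤k noClique

    contradiction : 2 * k * (k ∸ 1) ≤ Z * (newArcs L₀ + kk * above L₀) → ⊥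
    contradiction A≤ = no-room (edgeCountsAbove<numEdgeCounts Hs L₀∈)
      (≤-trans (≤-reflexive (sym (*-assoc (numEdgeCounts Hs) kk Z))) bound)
      (≤-trans A≤ (≤-reflexive (begin-equality
        Z * (newArcs L₀ + kk * above L₀)
          ≡⟨ cong (λ x → Z * (x + kk * above L₀)) (orderedEdges-∖-self (graph L₀) full) ⟩
        Z * (0 + kk * above L₀)           ≡⟨ regroup Z kk (above L₀) ⟩
        above L₀ * (kk * Z)               ∎)))
      (positive (≤-trans (2≤2^[2*n] 1≤k′) M≤k))
      where
      open ≤-Reasoning
      regroup : ∀ Z kk a → Z * (0 + kk * a) ≡ a * (kk * Z)
      regroup = solve-∀
      positive : ∀ {k} → 2 ≤ k → 0 < 2 * k * (k ∸ 1)
      positive (s≤s (s≤s _)) = s≤s z≤n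

mainTheorem11 : (k k' : ℕ) → 2 ^ (2 * k') ≤ k →
    (Hs : List (LabelledGraph k)) → Hs ≢ [] →
    numEdgeCounts Hs * ((k ∸ 2) C (k' ∸ 2)) * (k' C 2) * (2 ^ (2 * k')) ! * (k ∸ k') !
    ≤ (2 ^ (2 * k') ∸ k') ! * k ! →
    Any (λ L → GoodForCliques Hs k' L ⊎ GoodForIndepSets Hs k' L) Hs
mainTheorem11 k k' M≤k []       []≢[] _   = ⊥-elim ([]≢[] refl)
mainTheorem11 k k' M≤k (L ∷ Ls) _     hyp =
  good-from-minimal k' (L ∷ Ls) M≤k (hypothesis⇒bound (numEdgeCounts (L ∷ Ls)) k'≤M M≤k hyp) L₀∈ L₀-min
  where
  L₀ = argmin edgeCountOf L Ls

  L₀∈ : L₀ ∈ˡ L ∷ Ls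
  L₀∈ = [ here , there ]′ (argmin-sel edgeCountOf L Ls)

  L₀-min : All (λ L′ → edgeCountOf L₀ ≤ edgeCountOf L′) (L ∷ Ls)
  L₀-min = f[argmin]≤f[⊤] {f = edgeCountOf} L Ls ∷ f[argmin]≤f[xs] {f = edgeCountOf} L Ls

  k'≤M : k' ≤ 2 ^ (2 * k')
  k'≤M = ≤-trans (<⇒≤ (n<2^n k')) (^-monoʳ-≤ 2 (m≤n*m k' 2))
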